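{- Let $n\ge 2$ and $\alpha\in S_n$, and let $P_\alpha=\{(i,\alpha(i)) : 1\le i\le n\}$. Then: \begin{enumerate} \item $P_\alpha$ has exactly two points on the boundary of its bounding square if and only if $\alpha$ commutes with the transposition $(1\; n)$; \item for $m\in\{3,4\}$, $P_\alpha$ has exactly $m$ points on the boundary of its bounding square if and only if $\alpha$ $m$-commutes with the transposition $(1\; n)$. \end{enumerate}
   Context: $S_n$ is the group of permutations of $[n]=\{1,\dots,n\}$; products are composed right to left. The Hamming distance between $\sigma,\tau\in S_n$ is $H(\sigma,\tau)=|\{a\in[n]:\sigma(a)\neq\tau(a)\}|$, and $\alpha,\beta$ $m$-commute if $H(\alpha\beta,\beta\alpha)=m$. The bounding square of $P_\alpha$ is the smallest axis-parallel square containing $P_\alpha$, i.e. the square with corners $(1,1)$ and $(n,n)$; a point $(i,\alpha(i))$ lies on its boundary iff $i\in\{1,n\}$ or $\alpha(i)\in\{1,n\}$. -}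

module Defs where

open import Data.Nat using (ℕ; suc)
open import Data.Fin using (Fin; zero; fromℕ; _≟_)
open import Data.Fin.Permutation using (Permutation′; _⟨$⟩ʳ_; transpose)
open import Data.List using (List; length; filter)
open import Data.List.Base using (allFin)
open import Data.Sum using (_⊎_)
open import Relation.Nullary using (¬_; ¬?)
open import Relation.Nullary.Decidable using (_⊎-dec_)
open import Relation.Binary.PropositionalEquality using (_≡_)

-- We work with S_(suc k) (so n = suc k); points are indexed by Fin (suc k),
-- where index 0 stands for 1 and index k (= fromℕ k) stands for n.

first : ∀ {k} → Fin (suc k)
first = zero

last : ∀ {k} → Fin (suc k)
last {k} = fromℕ k

_·_ : ∀ {k} → Permutation′ (suc k) → Permutation′ (suc k) → Fin (suc k) → Fin (suc k)
(α · β) a = α ⟨$⟩ʳ (β ⟨$⟩ʳ a)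

H : ∀ {k} → (Fin (suc k) → Fin (suc k)) → (Fin (suc k) → Fin (suc k)) → ℕ
H σ τ = length (filter (λ a → ¬? (σ a ≟ τ a)) (allFin _))

m-commute : ∀ {k} → ℕ → Permutation′ (suc k) → Permutation′ (suc k) → Set
m-commute m α β = H (α · β) (β · α) ≡ m

τ1n : ∀ {k} → Permutation′ (suc k)
τ1n = transpose first last

boundaryCount : ∀ {k} → Permutation′ (suc k) → ℕ
boundaryCount {k} α =
  length (filter (λ i → ((i ≟ first) ⊎-dec (i ≟ last)) ⊎-dec ((α ⟨$⟩ʳ i ≟ first) ⊎-dec (α ⟨$⟩ʳ i ≟ last))) (allFin (suc k)))

-- Let τ = (p q) be a transposition of [n], α a permutation, u = α⁻¹(p),
-- v = α⁻¹(q), and call p, q the ends.  Both quantities in the theorem are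
-- sums of 0/1-indicators over [n], and pointwise each indicator is a sum of
-- at most four point masses, located at p, q, u, v:
--   * (i, α i) is a boundary point iff i is an end, or i is interior and
--     i ∈ {u, v}; hence  #boundary = 2 + d  with d = [u interior] + [v interior];
--   * α τ and τ α disagree at an interior i iff α i is an end, i.e. i ∈ {u, v},
--     and they disagree at p iff they disagree at q; hence
--     H(ατ, τα) = 2·[mismatch at p] + d.
-- Finally, ατ and τα agree at p iff α maps {p, q} onto itself, i.e. iff d = 0.
-- So either #boundary = 2 and H = 0, or #boundary > 2 and H = #boundary, from
-- which both parts follow (part 2 even for every m > 2).

module Submission where

open import Defs
open import Data.Nat using (ℕ; zero; suc; _+_; _*_; _≤_; _<_; z≤n; s≤s)
open import Data.Nat.Properties
  using (+-identityʳ; *-identityˡ; *-identityʳ; *-zeroʳ; *-comm; *-distribˡ-+;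
         m+n≡0⇒m≡0; m+n≡0⇒n≡0; n≢0⇒n>0; +-monoʳ-<; <-irrefl; n≮0; +-0-commutativeMonoid)
open import Data.Fin using (Fin; zero; suc)
open import Data.Fin.Properties using (_≟_)
open import Data.Fin.Permutation using (Permutation′; _⟨$⟩ʳ_; _⟨$⟩ˡ_; inverseˡ; inverseʳ; transpose)
open import Data.List using (List; length; filter; tabulate; allFin)
open import Data.List.Membership.Propositional using (_∈_)
open import Data.List.Membership.Propositional.Properties using (∈-filter⁺; ∈-allFin)
open import Data.List.Relation.Unary.All.Properties using (tabulate⁺)
open import Data.List.Relation.Unary.Any using (here; there)
open import Data.List.Properties using (filter-none)
open import Data.Bool using (if_then_else_)
open import Data.Product using (_×_; _,_)
open import Data.Sum using (_⊎_; inj₁; inj₂)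
open import Data.Empty using (⊥; ⊥-elim)
open import Function using (_∘_)
open import Function.Bundles using (_⇔_; mk⇔; Equivalence)
open import Relation.Nullary using (Dec; yes; no; does; ¬_; ¬?; contradiction)
open import Relation.Nullary.Decidable using (_⊎-dec_; dec-true; dec-false)
open import Relation.Unary using (Decidable)
open import Relation.Binary.PropositionalEquality using (_≡_; _≢_; refl; sym; trans; cong; cong₂; subst; module ≡-Reasoning)
open import Algebra.Properties.CommutativeMonoid.Sum +-0-commutativeMonoid
  using (sum; sum-syntax; ∑-distrib-+; sum-cong-≗; sum-replicate-zero)

open ≡-Reasoning

private variable
  P Q : Set

𝟙 : Dec P → ℕ
𝟙 d = if does d then 1 else 0

𝟙-bit : (d : Dec P) → 𝟙 d ≡ 0 ⊎ 𝟙 d ≡ 1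
𝟙-bit (yes _) = inj₂ refl
𝟙-bit (no _)  = inj₁ refl

𝟙-cong : (P → Q) → (Q → P) → (d : Dec P) (e : Dec Q) → 𝟙 d ≡ 𝟙 e
𝟙-cong P→Q Q→P (yes x) (yes y) = refl
𝟙-cong P→Q Q→P (yes x) (no ¬y) = contradiction (P→Q x) ¬y
𝟙-cong P→Q Q→P (no ¬x) (yes y) = contradiction (Q→P y) ¬x
𝟙-cong P→Q Q→P (no ¬x) (no ¬y) = refl

𝟙¬≡0⇒ : (d : Dec P) → 𝟙 (¬? d) ≡ 0 → P
𝟙¬≡0⇒ (yes x) _ = x

⇒𝟙¬≡0 : (d : Dec P) → P → 𝟙 (¬? d) ≡ 0
⇒𝟙¬≡0 (yes _) _ = refl
⇒𝟙¬≡0 (no ¬x) x = contradiction x ¬x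

𝟙-⊎ : (d : Dec P) (e : Dec Q) → 𝟙 (d ⊎-dec e) ≡ 𝟙 d + 𝟙 (¬? d) * 𝟙 e
𝟙-⊎ (yes _) e      = refl
𝟙-⊎ (no _) (yes _) = refl
𝟙-⊎ (no _) (no _)  = refl

𝟙-⊎-disjoint : (P → Q → ⊥) → (d : Dec P) (e : Dec Q) → 𝟙 (d ⊎-dec e) ≡ 𝟙 d + 𝟙 e
𝟙-⊎-disjoint P∧Q→⊥ (yes x) (yes y) = ⊥-elim (P∧Q→⊥ x y)
𝟙-⊎-disjoint P∧Q→⊥ (yes _) (no _)  = refl
𝟙-⊎-disjoint P∧Q→⊥ (no _) (yes _)  = refl
𝟙-⊎-disjoint P∧Q→⊥ (no _) (no _)   = refl

count≡∑ : ∀ {A : Set} {P : A → Set} {m} (P? : Decidable P) (g : Fin m → A) →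
          length (filter P? (tabulate g)) ≡ ∑[ a < m ] 𝟙 (P? (g a))
count≡∑ {m = zero}  P? g = refl
count≡∑ {m = suc m} P? g with P? (g zero)
... | yes _ = cong suc (count≡∑ P? (g ∘ suc))
... | no _  = count≡∑ P? (g ∘ suc)

pointMass : ∀ {n} → Fin n → ℕ → Fin n → ℕ
pointMass b c a = 𝟙 (a ≟ b) * c

∑-pointMass : ∀ {n} (b : Fin n) (c : ℕ) → ∑[ a < n ] pointMass b c a ≡ c
∑-pointMass {suc n} zero c = begin
  (c + 0) + ∑[ a < n ] 0  ≡⟨ cong ((c + 0) +_) (sum-replicate-zero n) ⟩
  (c + 0) + 0             ≡⟨ +-identityʳ (c + 0) ⟩
  c + 0                   ≡⟨ +-identityʳ c ⟩
  c                       ∎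
∑-pointMass {suc n} (suc b) c = ∑-pointMass b c

pointMass-localise : ∀ {n} (f : Fin n → ℕ) (a b : Fin n) → f a * 𝟙 (a ≟ b) ≡ pointMass b (f b) a
pointMass-localise f a b with a ≟ b
... | yes refl = *-comm (f a) 1
... | no _     = *-zeroʳ (f a)

-- The sum of four point masses; both counts of the theorem have this shape.
∑-pointMass⁴ : ∀ {n} (b₁ b₂ b₃ b₄ : Fin n) (c₁ c₂ c₃ c₄ : ℕ) →
  ∑[ a < n ] ((pointMass b₁ c₁ a + pointMass b₂ c₂ a) + (pointMass b₃ c₃ a + pointMass b₄ c₄ a))
    ≡ (c₁ + c₂) + (c₃ + c₄)
∑-pointMass⁴ {n} b₁ b₂ b₃ b₄ c₁ c₂ c₃ c₄ = begin
  ∑[ a < n ] ((m₁ a + m₂ a) + (m₃ a + m₄ a))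
    ≡⟨ ∑-distrib-+ (λ a → m₁ a + m₂ a) (λ a → m₃ a + m₄ a) ⟩
  ∑[ a < n ] (m₁ a + m₂ a) + ∑[ a < n ] (m₃ a + m₄ a)
    ≡⟨ cong₂ _+_ (∑-distrib-+ m₁ m₂) (∑-distrib-+ m₃ m₄) ⟩
  (sum m₁ + sum m₂) + (sum m₃ + sum m₄)
    ≡⟨ cong₂ _+_ (cong₂ _+_ (∑-pointMass b₁ c₁) (∑-pointMass b₂ c₂))
                 (cong₂ _+_ (∑-pointMass b₃ c₃) (∑-pointMass b₄ c₄)) ⟩
  (c₁ + c₂) + (c₃ + c₄) ∎
  where
  m₁ m₂ m₃ m₄ : Fin n → ℕ
  m₁ = pointMass b₁ c₁
  m₂ = pointMass b₂ c₂
  m₃ = pointMass b₃ c₃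
  m₄ = pointMass b₄ c₄

H≡0⇔equal : ∀ {k} (σ ρ : Fin (suc k) → Fin (suc k)) → (H σ ρ ≡ 0) ⇔ (∀ a → σ a ≡ ρ a)
H≡0⇔equal σ ρ = mk⇔ equal (λ σ≗ρ → cong length (filter-none differ? (tabulate⁺ (λ a ¬≡ → ¬≡ (σ≗ρ a)))))
  where
  differ? : Decidable (λ a → σ a ≢ ρ a)
  differ? a = ¬? (σ a ≟ ρ a)

  nonEmpty : ∀ {a} {xs : List (Fin _)} → a ∈ xs → length xs ≢ 0
  nonEmpty (here _)  ()
  nonEmpty (there _) ()

  equal : H σ ρ ≡ 0 → ∀ a → σ a ≡ ρ a
  equal H≡0 a with σ a ≟ ρ a
  ... | yes σa≡ρa = σa≡ρa
  ... | no σa≢ρa  = ⊥-elim (nonEmpty (∈-filter⁺ differ? (∈-allFin a) σa≢ρa) H≡0)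

module Transposition {k : ℕ} (p q : Fin (suc k)) (p≢q : p ≢ q) (α : Permutation′ (suc k)) where

  τ : Permutation′ (suc k)
  τ = transpose p q

  α⟨_⟩ τ⟨_⟩ : Fin (suc k) → Fin (suc k)
  α⟨ x ⟩ = α ⟨$⟩ʳ x
  τ⟨ x ⟩ = τ ⟨$⟩ʳ x

  End : Fin (suc k) → Set
  End x = x ≡ p ⊎ x ≡ q

  End? : Decidable End
  End? x = (x ≟ p) ⊎-dec (x ≟ q)

  interior : Fin (suc k) → ℕ
  interior x = 𝟙 (¬? (End? x))

  u v : Fin (suc k)
  u = α ⟨$⟩ˡ p
  v = α ⟨$⟩ˡ q

  commutes? : ∀ a → Dec (α⟨ τ⟨ a ⟩ ⟩ ≡ τ⟨ α⟨ a ⟩ ⟩)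
  commutes? a = α⟨ τ⟨ a ⟩ ⟩ ≟ τ⟨ α⟨ a ⟩ ⟩

  mismatch : Fin (suc k) → ℕ
  mismatch a = 𝟙 (¬? (commutes? a))

  boundaryPoints : ℕ
  boundaryPoints = length (filter (λ i → End? i ⊎-dec End? α⟨ i ⟩) (allFin (suc k)))

  hamming : ℕ
  hamming = H (α · τ) (τ · α)

  displaced : ℕ
  displaced = interior u + interior v

  τ⟨p⟩ : τ⟨ p ⟩ ≡ q
  τ⟨p⟩ rewrite dec-true (p ≟ p) refl = refl

  τ⟨q⟩ : τ⟨ q ⟩ ≡ p
  τ⟨q⟩ rewrite dec-false (q ≟ p) (p≢q ∘ sym) | dec-true (q ≟ q) refl = refl

  τ-fixes-interior : ∀ {x} → ¬ End x → τ⟨ x ⟩ ≡ x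
  τ-fixes-interior {x} ¬end
    rewrite dec-false (x ≟ p) (¬end ∘ inj₁) | dec-false (x ≟ q) (¬end ∘ inj₂) = refl

  τ-involutive : ∀ x → τ⟨ τ⟨ x ⟩ ⟩ ≡ x
  τ-involutive x with End? x
  ... | yes (inj₁ refl) = trans (cong τ⟨_⟩ τ⟨p⟩) τ⟨q⟩
  ... | yes (inj₂ refl) = trans (cong τ⟨_⟩ τ⟨q⟩) τ⟨p⟩
  ... | no ¬end         = trans (cong τ⟨_⟩ (τ-fixes-interior ¬end)) (τ-fixes-interior ¬end)

  moved⇔End : ∀ x → 𝟙 (¬? (x ≟ τ⟨ x ⟩)) ≡ 𝟙 (End? x)
  moved⇔End x = 𝟙-cong moved⇒End End⇒moved (¬? (x ≟ τ⟨ x ⟩)) (End? x)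
    where
    moved⇒End : x ≢ τ⟨ x ⟩ → End x
    moved⇒End moved with End? x
    ... | yes end = end
    ... | no ¬end = contradiction (sym (τ-fixes-interior ¬end)) moved
    End⇒moved : End x → x ≢ τ⟨ x ⟩
    End⇒moved (inj₁ refl) x≡τx = p≢q (trans x≡τx τ⟨p⟩)
    End⇒moved (inj₂ refl) x≡τx = p≢q (sym (trans x≡τx τ⟨q⟩))

  α-injective : ∀ {x y} → α⟨ x ⟩ ≡ α⟨ y ⟩ → x ≡ y
  α-injective {x} {y} αx≡αy = trans (sym (inverseˡ α)) (trans (cong (α ⟨$⟩ˡ_) αx≡αy) (inverseˡ α))

  α⇒preimage : ∀ {x y} → α⟨ x ⟩ ≡ y → x ≡ α ⟨$⟩ˡ y
  α⇒preimage refl = sym (inverseˡ α)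

  preimage⇒α : ∀ {x y} → x ≡ α ⟨$⟩ˡ y → α⟨ x ⟩ ≡ y
  preimage⇒α refl = inverseʳ α

  ends-part : ∀ (f : Fin (suc k) → ℕ) a → f a * 𝟙 (End? a) ≡ pointMass p (f p) a + pointMass q (f q) a
  ends-part f a = begin
    f a * 𝟙 (End? a)                    ≡⟨ cong (f a *_) (𝟙-⊎-disjoint (λ a≡p a≡q → p≢q (trans (sym a≡p) a≡q)) (a ≟ p) (a ≟ q)) ⟩
    f a * (𝟙 (a ≟ p) + 𝟙 (a ≟ q))       ≡⟨ *-distribˡ-+ (f a) (𝟙 (a ≟ p)) (𝟙 (a ≟ q)) ⟩
    f a * 𝟙 (a ≟ p) + f a * 𝟙 (a ≟ q)   ≡⟨ cong₂ _+_ (pointMass-localise f a p) (pointMass-localise f a q) ⟩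
    pointMass p (f p) a + pointMass q (f q) a ∎

  interior-to-end : ∀ a → interior a * 𝟙 (End? α⟨ a ⟩) ≡ pointMass u (interior u) a + pointMass v (interior v) a
  interior-to-end a = begin
    interior a * 𝟙 (End? α⟨ a ⟩)
      ≡⟨ cong (interior a *_) (𝟙-⊎-disjoint (λ αa≡p αa≡q → p≢q (trans (sym αa≡p) αa≡q)) (α⟨ a ⟩ ≟ p) (α⟨ a ⟩ ≟ q)) ⟩
    interior a * (𝟙 (α⟨ a ⟩ ≟ p) + 𝟙 (α⟨ a ⟩ ≟ q))
      ≡⟨ cong (interior a *_) (cong₂ _+_ (𝟙-cong α⇒preimage preimage⇒α (α⟨ a ⟩ ≟ p) (a ≟ u))
                                         (𝟙-cong α⇒preimage preimage⇒α (α⟨ a ⟩ ≟ q) (a ≟ v))) ⟩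
    interior a * (𝟙 (a ≟ u) + 𝟙 (a ≟ v))
      ≡⟨ *-distribˡ-+ (interior a) (𝟙 (a ≟ u)) (𝟙 (a ≟ v)) ⟩
    interior a * 𝟙 (a ≟ u) + interior a * 𝟙 (a ≟ v)
      ≡⟨ cong₂ _+_ (pointMass-localise interior a u) (pointMass-localise interior a v) ⟩
    pointMass u (interior u) a + pointMass v (interior v) a ∎

  boundary-pointwise : ∀ a → 𝟙 (End? a ⊎-dec End? α⟨ a ⟩)
    ≡ (pointMass p 1 a + pointMass q 1 a) + (pointMass u (interior u) a + pointMass v (interior v) a)
  boundary-pointwise a = begin
    𝟙 (End? a ⊎-dec End? α⟨ a ⟩)                ≡⟨ 𝟙-⊎ (End? a) (End? α⟨ a ⟩) ⟩
    𝟙 (End? a) + interior a * 𝟙 (End? α⟨ a ⟩)   ≡⟨ cong₂ _+_ (sym (*-identityˡ (𝟙 (End? a)))) (interior-to-end a) ⟩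
    1 * 𝟙 (End? a) + preimages                  ≡⟨ cong (_+ preimages) (ends-part (λ _ → 1) a) ⟩
    (pointMass p 1 a + pointMass q 1 a) + preimages ∎
    where
    preimages : ℕ
    preimages = pointMass u (interior u) a + pointMass v (interior v) a

  -- At an interior point, α τ and τ α disagree iff α sends it to an end.
  mismatch-split : ∀ a → mismatch a ≡ mismatch a * 𝟙 (End? a) + interior a * 𝟙 (End? α⟨ a ⟩)
  mismatch-split a = by-cases (End? a)
    where
    by-cases : (end? : Dec (End a)) → mismatch a ≡ mismatch a * 𝟙 end? + 𝟙 (¬? end?) * 𝟙 (End? α⟨ a ⟩)
    by-cases (yes _)   = trans (sym (*-identityʳ (mismatch a))) (sym (+-identityʳ _))
    by-cases (no ¬end) = begin
      mismatch a                             ≡⟨ cong (λ x → 𝟙 (¬? (α⟨ x ⟩ ≟ τ⟨ α⟨ a ⟩ ⟩))) (τ-fixes-interior ¬end) ⟩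
      𝟙 (¬? (α⟨ a ⟩ ≟ τ⟨ α⟨ a ⟩ ⟩))         ≡⟨ moved⇔End α⟨ a ⟩ ⟩
      𝟙 (End? α⟨ a ⟩)                        ≡⟨ sym (*-identityˡ _) ⟩
      1 * 𝟙 (End? α⟨ a ⟩)                    ≡⟨ cong (_+ 1 * 𝟙 (End? α⟨ a ⟩)) (sym (*-zeroʳ (mismatch a))) ⟩
      mismatch a * 0 + 1 * 𝟙 (End? α⟨ a ⟩)   ∎

  mismatch-pointwise : ∀ a → mismatch a
    ≡ (pointMass p (mismatch p) a + pointMass q (mismatch q) a) + (pointMass u (interior u) a + pointMass v (interior v) a)
  mismatch-pointwise a = trans (mismatch-split a) (cong₂ _+_ (ends-part mismatch a) (interior-to-end a))

  boundaryPoints≡ : boundaryPoints ≡ 2 + displaced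
  boundaryPoints≡ = begin
    boundaryPoints  ≡⟨ count≡∑ (λ i → End? i ⊎-dec End? α⟨ i ⟩) (λ a → a) ⟩
    ∑[ a < suc k ] 𝟙 (End? a ⊎-dec End? α⟨ a ⟩) ≡⟨ sum-cong-≗ boundary-pointwise ⟩
    _               ≡⟨ ∑-pointMass⁴ p q u v 1 1 (interior u) (interior v) ⟩
    2 + displaced   ∎

  hamming≡ : hamming ≡ (mismatch p + mismatch q) + displaced
  hamming≡ = begin
    hamming            ≡⟨ count≡∑ (λ a → ¬? ((α · τ) a ≟ (τ · α) a)) (λ a → a) ⟩
    sum mismatch       ≡⟨ sum-cong-≗ mismatch-pointwise ⟩
    _                  ≡⟨ ∑-pointMass⁴ p q u v (mismatch p) (mismatch q) (interior u) (interior v) ⟩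
    (mismatch p + mismatch q) + displaced ∎

  -- Conjugating by τ swaps the roles of p and q.
  mismatch-q≡p : mismatch q ≡ mismatch p
  mismatch-q≡p = 𝟙-cong (λ ≢ → ≢ ∘ swap-commutation p q τ⟨p⟩ τ⟨q⟩) (λ ≢ → ≢ ∘ swap-commutation q p τ⟨q⟩ τ⟨p⟩)
                        (¬? (commutes? q)) (¬? (commutes? p))
    where
    swap-commutation : ∀ x y → τ⟨ x ⟩ ≡ y → τ⟨ y ⟩ ≡ x → α⟨ τ⟨ x ⟩ ⟩ ≡ τ⟨ α⟨ x ⟩ ⟩ → α⟨ τ⟨ y ⟩ ⟩ ≡ τ⟨ α⟨ y ⟩ ⟩
    swap-commutation x y τx≡y τy≡x commutes = begin
      α⟨ τ⟨ y ⟩ ⟩          ≡⟨ cong α⟨_⟩ τy≡x ⟩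
      α⟨ x ⟩               ≡⟨ sym (τ-involutive α⟨ x ⟩) ⟩
      τ⟨ τ⟨ α⟨ x ⟩ ⟩ ⟩     ≡⟨ cong τ⟨_⟩ (sym commutes) ⟩
      τ⟨ α⟨ τ⟨ x ⟩ ⟩ ⟩     ≡⟨ cong (λ z → τ⟨ α⟨ z ⟩ ⟩) τx≡y ⟩
      τ⟨ α⟨ y ⟩ ⟩          ∎

  same-preimage : ∀ {x} → u ≡ x → v ≡ x → p ≡ q
  same-preimage u≡x v≡x = trans (sym (preimage⇒α (sym u≡x))) (preimage⇒α (sym v≡x))

  commutes-at-p⇒ends-preserved : α⟨ τ⟨ p ⟩ ⟩ ≡ τ⟨ α⟨ p ⟩ ⟩ → End u × End v
  commutes-at-p⇒ends-preserved commutes = by-cases (End? α⟨ p ⟩)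
    where
    αq≡ταp : α⟨ q ⟩ ≡ τ⟨ α⟨ p ⟩ ⟩
    αq≡ταp = trans (cong α⟨_⟩ (sym τ⟨p⟩)) commutes

    by-cases : Dec (End α⟨ p ⟩) → End u × End v
    by-cases (yes (inj₁ αp≡p)) =
      inj₁ (sym (α⇒preimage αp≡p)) , inj₂ (sym (α⇒preimage (trans αq≡ταp (trans (cong τ⟨_⟩ αp≡p) τ⟨p⟩))))
    by-cases (yes (inj₂ αp≡q)) =
      inj₂ (sym (α⇒preimage (trans αq≡ταp (trans (cong τ⟨_⟩ αp≡q) τ⟨q⟩)))) , inj₁ (sym (α⇒preimage αp≡q))
    by-cases (no ¬end) = contradiction (α-injective (trans αq≡ταp (τ-fixes-interior ¬end))) (p≢q ∘ sym)

  ends-preserved⇒commutes-at-p : End u → End v → α⟨ τ⟨ p ⟩ ⟩ ≡ τ⟨ α⟨ p ⟩ ⟩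
  ends-preserved⇒commutes-at-p (inj₁ u≡p) (inj₂ v≡q) = begin
    α⟨ τ⟨ p ⟩ ⟩  ≡⟨ cong α⟨_⟩ τ⟨p⟩ ⟩
    α⟨ q ⟩       ≡⟨ preimage⇒α (sym v≡q) ⟩
    q            ≡⟨ sym τ⟨p⟩ ⟩
    τ⟨ p ⟩       ≡⟨ cong τ⟨_⟩ (sym (preimage⇒α (sym u≡p))) ⟩
    τ⟨ α⟨ p ⟩ ⟩  ∎
  ends-preserved⇒commutes-at-p (inj₂ u≡q) (inj₁ v≡p) = begin
    α⟨ τ⟨ p ⟩ ⟩  ≡⟨ cong α⟨_⟩ τ⟨p⟩ ⟩
    α⟨ q ⟩       ≡⟨ preimage⇒α (sym u≡q) ⟩
    p            ≡⟨ sym τ⟨q⟩ ⟩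
    τ⟨ q ⟩       ≡⟨ cong τ⟨_⟩ (sym (preimage⇒α (sym v≡p))) ⟩
    τ⟨ α⟨ p ⟩ ⟩  ∎
  ends-preserved⇒commutes-at-p (inj₁ u≡p) (inj₁ v≡p) = contradiction (same-preimage u≡p v≡p) p≢q
  ends-preserved⇒commutes-at-p (inj₂ u≡q) (inj₂ v≡q) = contradiction (same-preimage u≡q v≡q) p≢q


  mismatch-p≡0⇔displaced≡0 : (mismatch p ≡ 0) ⇔ (displaced ≡ 0)
  mismatch-p≡0⇔displaced≡0 = mk⇔ to from
    where
    to : mismatch p ≡ 0 → displaced ≡ 0
    to mismatch-p≡0 with commutes-at-p⇒ends-preserved (𝟙¬≡0⇒ (commutes? p) mismatch-p≡0)
    ... | end-u , end-v = cong₂ _+_ (⇒𝟙¬≡0 (End? u) end-u) (⇒𝟙¬≡0 (End? v) end-v)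
    from : displaced ≡ 0 → mismatch p ≡ 0
    from displaced≡0 = ⇒𝟙¬≡0 (commutes? p) (ends-preserved⇒commutes-at-p
      (𝟙¬≡0⇒ (End? u) (m+n≡0⇒m≡0 (interior u) displaced≡0))
      (𝟙¬≡0⇒ (End? v) (m+n≡0⇒n≡0 (interior u) displaced≡0)))

  dichotomy : (boundaryPoints ≡ 2 × hamming ≡ 0) ⊎ (2 < boundaryPoints × hamming ≡ boundaryPoints)
  dichotomy with 𝟙-bit (¬? (commutes? p))
  ... | inj₁ mismatch-p≡0 = inj₁ (count≡2 , hamming≡0)
    where
    displaced≡0 : displaced ≡ 0
    displaced≡0 = Equivalence.to mismatch-p≡0⇔displaced≡0 mismatch-p≡0
    count≡2 : boundaryPoints ≡ 2
    count≡2 = trans boundaryPoints≡ (cong (2 +_) displaced≡0)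
    hamming≡0 : hamming ≡ 0
    hamming≡0 = trans hamming≡ (cong₂ _+_ (cong₂ _+_ mismatch-p≡0 (trans mismatch-q≡p mismatch-p≡0)) displaced≡0)
  ... | inj₂ mismatch-p≡1 = inj₂ (2<count , hamming≡count)
    where
    displaced≢0 : displaced ≢ 0
    displaced≢0 displaced≡0 = contradiction (trans (sym mismatch-p≡1) (Equivalence.from mismatch-p≡0⇔displaced≡0 displaced≡0)) λ ()
    2<count : 2 < boundaryPoints
    2<count = subst (2 <_) (sym boundaryPoints≡) (+-monoʳ-< 2 (n≢0⇒n>0 displaced≢0))
    hamming≡count : hamming ≡ boundaryPoints
    hamming≡count = begin
      hamming                                ≡⟨ hamming≡ ⟩
      (mismatch p + mismatch q) + displaced  ≡⟨ cong (λ m → (mismatch p + m) + displaced) mismatch-q≡p ⟩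
      (mismatch p + mismatch p) + displaced  ≡⟨ cong (λ m → (m + m) + displaced) mismatch-p≡1 ⟩
      2 + displaced                          ≡⟨ sym boundaryPoints≡ ⟩
      boundaryPoints                         ∎

  two-points⇔commute : (boundaryPoints ≡ 2) ⇔ (∀ a → (α · τ) a ≡ (τ · α) a)
  two-points⇔commute with dichotomy
  ... | inj₁ (count≡2 , hamming≡0) = mk⇔ (λ _ → Equivalence.to (H≡0⇔equal (α · τ) (τ · α)) hamming≡0) (λ _ → count≡2)
  ... | inj₂ (2<count , hamming≡count) = mk⇔
    (λ count≡2 → ⊥-elim (<-irrefl (sym count≡2) 2<count))
    (λ commute → ⊥-elim (n≮0 (subst (2 <_) (trans (sym hamming≡count) (Equivalence.from (H≡0⇔equal (α · τ) (τ · α)) commute)) 2<count)))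

  m-points⇔m-commute : ∀ m → 2 < m → (boundaryPoints ≡ m) ⇔ m-commute m α τ
  m-points⇔m-commute m 2<m with dichotomy
  ... | inj₁ (count≡2 , hamming≡0) = mk⇔
    (λ count≡m → ⊥-elim (<-irrefl (trans (sym count≡2) count≡m) 2<m))
    (λ hamming≡m → ⊥-elim (n≮0 (subst (2 <_) (trans (sym hamming≡m) hamming≡0) 2<m)))
  ... | inj₂ (_ , hamming≡count) = mk⇔ (trans hamming≡count) (trans (sym hamming≡count))

proposition4p2 : ∀ (k : ℕ) → 1 ≤ k → (α : Permutation′ (suc k)) →
    ((boundaryCount α ≡ 2) ⇔ (∀ (a : Fin (suc k)) → (α · τ1n) a ≡ (τ1n · α) a))
    × ((boundaryCount α ≡ 3) ⇔ (m-commute 3 α τ1n))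
    × ((boundaryCount α ≡ 4) ⇔ (m-commute 4 α τ1n))
proposition4p2 zero () α
proposition4p2 (suc k) _ α = two-points⇔commute , m-points⇔m-commute 3 2<3 , m-points⇔m-commute 4 2<4
  where
  open Transposition first last (λ ()) α
  2<3 : 2 < 3
  2<3 = s≤s (s≤s (s≤s z≤n))
  2<4 : 2 < 4
  2<4 = s≤s (s≤s (s≤s z≤n))
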